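{- For all integers $m,n\geq 3$, the number of brushes needed to clean $C_m \times C_n$ is at least $2(m+n-2)$; that is, $b(C_m\times C_n)\geq 2(m+n-2)$.
   Context: For a finite simple graph $G$, the brush number $b(G)$ is the minimum, over all acyclic orientations of the edges of $G$, of $\sum_{v\in V(G)} \max\{0,d^+(v)-d^-(v)\}$, where $d^+(v)$ and $d^-(v)$ are the outdegree and indegree of $v$ in the orientation. (Equivalently, it is the minimum number of brushes needed to clean $G$ in the graph cleaning process: initially all edges are dirty and brushes are placed on vertices; a vertex may be cleaned only if it holds at least as many brushes as incident dirty edges, in which case one brush is sent along each incident dirty edge, cleaning it.) $C_k$ denotes the cycle on $k$ vertices. The cartesian product $G\times H$ has vertex set $V(G)\times V(H)$, with $(a,b)$ adjacent to $(c,d)$ iff either $a=c$ and $bd\in E(H)$, or $ac\in E(G)$ and $b=d$. -}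

module Defs where

open import Level using (0ℓ)
open import Data.Bool using (Bool; T)
open import Data.Nat using (ℕ; zero; suc; _+_; _∸_)
open import Data.Fin using (Fin; toℕ)
open import Data.List using (List; length; filterᵇ; map; allFin; cartesianProduct)
open import Data.Nat.ListAction using (sum)
open import Data.Nat.Properties using (1+n≢n)
open import Data.Sum using (inj₁; inj₂)
open import Relation.Binary.PropositionalEquality using (refl; sym; trans; cong)
open import Data.Product using (_×_; _,_)
open import Data.Sum using (_⊎_)
open import Data.Empty using (⊥)
open import Relation.Nullary using (¬_)
open import Relation.Binary.PropositionalEquality using (_≡_)
open import Relation.Binary.Construct.Closure.Transitive using (TransClosure)

record Graph : Set₁ where
  field
    V     : Set
    verts : List V          -- lists every vertex exactly once
    Adj   : V → V → Set
    adjSym : ∀ {u v} → Adj u v → Adj v u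
    adjIrr : ∀ {u} → ¬ Adj u u
open Graph public

-- An orientation of G: arc u v = true means the edge uv is directed u → v.
-- Every edge gets exactly one direction and arcs only occur on edges.
record IsOrientation (G : Graph) (arc : V G → V G → Bool) : Set where
  field
    onEdges : ∀ u v → T (arc u v) → Adj G u v
    covers  : ∀ u v → Adj G u v → T (arc u v) ⊎ T (arc v u)
    antisym : ∀ u v → T (arc u v) → T (arc v u) → ⊥

Acyclic : (G : Graph) → (V G → V G → Bool) → Set
Acyclic G arc = ∀ v → ¬ TransClosure (λ x y → T (arc x y)) v v

outdeg indeg : (G : Graph) → (V G → V G → Bool) → V G → ℕ
outdeg G arc v = length (filterᵇ (λ u → arc v u) (verts G))
indeg  G arc v = length (filterᵇ (λ u → arc u v) (verts G))

-- Σ_v max{0, d⁺(v) − d⁻(v)}  (truncated subtraction ∸ is exactly max{0,·})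
brushCost : (G : Graph) → (V G → V G → Bool) → ℕ
brushCost G arc = sum (map (λ v → outdeg G arc v ∸ indeg G arc v) (verts G))

-- b(G) ≥ k  iff every acyclic orientation has cost ≥ k  (b is the minimum).
BrushNumber≥ : Graph → ℕ → Set
BrushNumber≥ G k = ∀ (arc : V G → V G → Bool) → IsOrientation G arc → Acyclic G arc →
                   k Data.Nat.≤ brushCost G arc

CycAdj : (k : ℕ) → Fin k → Fin k → Set
CycAdj k i j = (suc (toℕ i) ≡ toℕ j) ⊎ (suc (toℕ j) ≡ toℕ i)
             ⊎ (suc (toℕ i) ≡ k × toℕ j ≡ 0) ⊎ (suc (toℕ j) ≡ k × toℕ i ≡ 0)

ProdAdj : (G H : Graph) → V G × V H → V G × V H → Set
ProdAdj G H (a , b) (c , d) = (a ≡ c × Adj H b d) ⊎ (Adj G a c × b ≡ d)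

CycAdj-sym : ∀ {k} {i j : Fin k} → CycAdj k i j → CycAdj k j i
CycAdj-sym (inj₁ p) = inj₂ (inj₁ p)
CycAdj-sym (inj₂ (inj₁ p)) = inj₁ p
CycAdj-sym (inj₂ (inj₂ (inj₁ p))) = inj₂ (inj₂ (inj₂ p))
CycAdj-sym (inj₂ (inj₂ (inj₂ p))) = inj₂ (inj₂ (inj₁ p))

wrapIrr : ∀ k → 3 Data.Nat.≤ k → (i : ℕ) → ¬ (suc i ≡ k × i ≡ 0)
wrapIrr (suc zero) (Data.Nat.s≤s ()) .zero (refl , refl)
wrapIrr (suc (suc (suc k))) _ .zero (() , refl)

CycAdj-irr : ∀ {k} → 3 Data.Nat.≤ k → {i : Fin k} → ¬ CycAdj k i i
CycAdj-irr _ {i} (inj₁ p) = 1+n≢n p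
CycAdj-irr _ {i} (inj₂ (inj₁ p)) = 1+n≢n p
CycAdj-irr {k} h {i} (inj₂ (inj₂ (inj₁ x))) = wrapIrr k h (toℕ i) x
CycAdj-irr {k} h {i} (inj₂ (inj₂ (inj₂ x))) = wrapIrr k h (toℕ i) x

Cycle : (k : ℕ) → 3 Data.Nat.≤ k → Graph
Cycle k h = record
  { V = Fin k ; verts = allFin k ; Adj = CycAdj k
  ; adjSym = CycAdj-sym ; adjIrr = CycAdj-irr h }

_□_ : Graph → Graph → Graph
G □ H = record
  { V = V G × V H
  ; verts = cartesianProduct (verts G) (verts H)
  ; Adj = ProdAdj G H
  ; adjSym = λ { (inj₁ (p , a)) → inj₁ (sym p , adjSym H a)
               ; (inj₂ (a , p)) → inj₂ (adjSym G a , sym p) }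
  ; adjIrr = λ { (inj₁ (_ , a)) → adjIrr H a
               ; (inj₂ (a , _)) → adjIrr G a } }

module Submission where

-- Fix an acyclic orientation of C_m × C_n.
--  (1) Acyclicity yields an injective height function p on the vertices with
--      p u < p v along every arc u → v (longest-path depth, tie-broken by a
--      code of the vertex); see module TopologicalLabel.
--  (2) Every vertex of the torus has degree 4 and d⁻(v) is the number of
--      neighbours of v with smaller height, so d⁺(v) ∸ d⁻(v) = 2·(2 ∸ d⁻(v))
--      and the brush cost is twice the total "deficit" Σ_v (2 ∸ lower(v)).
--  (3) The torus inequality (module TorusInequality): for every injective labelling of
--      ℤ_m × ℤ_n the total deficit is at least m + n − 2.  One takes the
--      threshold θ = the smallest row maximum (or column maximum, by symmetry)
--      and S = {labels < θ}; the deficit on S bounds the number of edges leaving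
--      S to the right and downward, and counting exits row by row and column by
--      column (with a correction for rows missing S) gives m + n − 2.
-- The file develops indicators and finite sums, periodic sequences, the torus
-- inequality, the height function, the counting of neighbours in C_m × C_n, and
-- finally derives the theorem.

open import Defs
open import Data.Nat using (ℕ; zero; suc; _+_; _*_; _∸_; _≤_; _<_; z≤n; s≤s; _<ᵇ_; _≡ᵇ_; _<?_; _≟_; _≤?_; NonZero; _%_; _/_; _⊔_)
open import Data.Nat.Properties
open import Data.Nat.DivMod
open import Algebra.Properties.CommutativeSemigroup +-commutativeSemigroup using (interchange; xy∙z≈xz∙y; x∙yz≈y∙xz)
open import Data.Nat.ListAction using (sum)
open import Data.Nat.ListAction.Properties using (sum-++)
open import Data.Nat.Tactic.RingSolver using (solve-∀)
open import Data.Bool using (Bool; true; false; not; _∧_; if_then_else_; T)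
open import Data.Product using (∃; _×_; _,_; proj₁; proj₂)
open import Data.Product.Properties using (≡-dec)
open import Data.Sum using (_⊎_; inj₁; inj₂)
open import Data.Empty using (⊥; ⊥-elim)
open import Data.Unit using (tt)
open import Relation.Nullary using (¬_; Dec; yes; no)
open import Relation.Binary.PropositionalEquality
open import Relation.Binary.Definitions using (tri<; tri≈; tri>)
open import Relation.Binary.Construct.Closure.Transitive using (TransClosure; [_]; _∷ʳ_)
open import Data.Fin using (Fin; toℕ; fromℕ<; combine; remQuot) renaming (zero to fzero; suc to fsuc)
open import Data.Fin.Properties using (pigeonhole; toℕ-injective; toℕ<n; fromℕ<-cong; toℕ-fromℕ<; fromℕ<-toℕ; remQuot-combine)
open import Data.List using (List; []; _∷_; map; foldr; _++_; length; filterᵇ; cartesianProduct; allFin; tabulate)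
open import Data.List.Properties using (map-++; map-∘)
open import Data.List.Relation.Unary.Any using (here; there)
open import Data.List.Membership.Propositional using (_∈_)
open import Data.List.Membership.Propositional.Properties using (∈-cartesianProduct⁺; ∈-allFin)

ι : Bool → ℕ
ι true = 1
ι false = 0

ι-split : ∀ x y → ι x ≡ ι (x ∧ y) + ι (x ∧ not y)
ι-split true true = refl
ι-split true false = refl
ι-split false y = refl

ι-not : ∀ b → ι (not b) + ι b ≡ 1
ι-not true = refl
ι-not false = refl

ι-*-≤ : ∀ b x → ι b * x ≤ x
ι-*-≤ true x = ≤-reflexive (+-identityʳ x)
ι-*-≤ false x = z≤n

ι-pos : ∀ b → 0 < ι b → b ≡ true
ι-pos true _ = refl

less : ℕ → ℕ → ℕ
less a b = ι (a <ᵇ b)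

less-0 : ∀ {a b} → b ≤ a → less a b ≡ 0
less-0 {a} {b} h with a <ᵇ b in eq
... | true = ⊥-elim (<⇒≱ (<ᵇ⇒< a b (subst T (sym eq) tt)) h)
... | false = refl

less-1 : ∀ {a b} → a < b → less a b ≡ 1
less-1 {a} {b} h with a <ᵇ b in eq
... | true = refl
... | false = ⊥-elim (subst T eq (<⇒<ᵇ h))

less-≤1 : ∀ a b → less a b ≤ 1
less-≤1 a b with a <ᵇ b
... | true = ≤-refl
... | false = z≤n

less-asym : ∀ a b → less a b + less b a ≤ 1
less-asym a b with <-cmp a b
... | tri< p _ _ rewrite less-1 p | less-0 {b} {a} (<⇒≤ p) = ≤-refl
... | tri≈ _ refl _ rewrite less-0 {a} {a} ≤-refl = z≤n
... | tri> _ _ p rewrite less-1 p | less-0 {a} {b} (<⇒≤ p) = ≤-refl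

less-antitone : ∀ {a a' b} → a ≤ a' → less a' b ≤ less a b
less-antitone {a} {a'} {b} h with a' <? b
... | yes p rewrite less-1 p | less-1 (≤-<-trans h p) = ≤-refl
... | no np rewrite less-0 {a'} {b} (≮⇒≥ np) = z≤n

Σ< : ℕ → (ℕ → ℕ) → ℕ
Σ< zero f = 0
Σ< (suc k) f = f 0 + Σ< k (λ t → f (suc t))

Σ-cong : ∀ k {f g : ℕ → ℕ} → (∀ t → t < k → f t ≡ g t) → Σ< k f ≡ Σ< k g
Σ-cong zero h = refl
Σ-cong (suc k) h = cong₂ _+_ (h 0 (s≤s z≤n)) (Σ-cong k (λ t t<k → h (suc t) (s≤s t<k)))

Σ-mono : ∀ k {f g : ℕ → ℕ} → (∀ t → t < k → f t ≤ g t) → Σ< k f ≤ Σ< k g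
Σ-mono zero h = z≤n
Σ-mono (suc k) h = +-mono-≤ (h 0 (s≤s z≤n)) (Σ-mono k (λ t t<k → h (suc t) (s≤s t<k)))

Σ-zero : ∀ k → Σ< k (λ _ → 0) ≡ 0
Σ-zero zero = refl
Σ-zero (suc k) = Σ-zero k

Σ-+ : ∀ k (f g : ℕ → ℕ) → Σ< k (λ t → f t + g t) ≡ Σ< k f + Σ< k g
Σ-+ zero f g = refl
Σ-+ (suc k) f g rewrite Σ-+ k (λ t → f (suc t)) (λ t → g (suc t)) =
  interchange (f 0) (g 0) (Σ< k (λ t → f (suc t))) (Σ< k (λ t → g (suc t)))

Σ-* : ∀ k c (h : ℕ → ℕ) → Σ< k (λ t → c * h t) ≡ c * Σ< k h
Σ-* zero c h = sym (*-zeroʳ c)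
Σ-* (suc k) c h = trans (cong (c * h 0 +_) (Σ-* k c (λ t → h (suc t)))) (sym (*-distribˡ-+ c (h 0) _))

Σ-snoc : ∀ k (f : ℕ → ℕ) → Σ< (suc k) f ≡ Σ< k f + f k
Σ-snoc zero f = +-comm (f 0) 0
Σ-snoc (suc k) f rewrite Σ-snoc k (λ t → f (suc t)) = sym (+-assoc (f 0) _ _)

Σ-swap : ∀ a b (F : ℕ → ℕ → ℕ) → Σ< a (λ i → Σ< b (λ j → F i j)) ≡ Σ< b (λ j → Σ< a (λ i → F i j))
Σ-swap zero b F = sym (Σ-zero b)
Σ-swap (suc a) b F =
  trans (cong (Σ< b (λ j → F 0 j) +_) (Σ-swap a b (λ i j → F (suc i) j)))
        (sym (Σ-+ b (λ j → F 0 j) (λ j → Σ< a (λ i → F (suc i) j))))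

Σ-term : ∀ k (f : ℕ → ℕ) t → t < k → f t ≤ Σ< k f
Σ-term (suc k) f zero h = m≤m+n (f 0) _
Σ-term (suc k) f (suc t) (s≤s h) = ≤-trans (Σ-term k (λ u → f (suc u)) t h) (m≤n+m _ (f 0))

Σ-prefix : ∀ k K (f : ℕ → ℕ) → k ≤ K → Σ< k f ≤ Σ< K f
Σ-prefix zero K f h = z≤n
Σ-prefix (suc k) (suc K) f (s≤s h) = +-monoʳ-≤ (f 0) (Σ-prefix k K (λ t → f (suc t)) h)

Σ-pos : ∀ k (f : ℕ → ℕ) → 0 < Σ< k f → ∃ λ t → t < k × 0 < f t
Σ-pos (suc k) f h with f 0 in e
... | suc x = 0 , s≤s z≤n , subst (0 <_) (sym e) (s≤s z≤n)
... | zero with Σ-pos k (λ t → f (suc t)) h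
... | t , t<k , p = suc t , s≤s t<k , p

Σ-zeroAt : ∀ k (f : ℕ → ℕ) → Σ< k f ≡ 0 → ∀ t → t < k → f t ≡ 0
Σ-zeroAt k f e t t<k = n≤0⇒n≡0 (subst (f t ≤_) e (Σ-term k f t t<k))

Σ-ones : ∀ k (f : ℕ → ℕ) → (∀ t → t < k → f t ≡ 1) → Σ< k f ≡ k
Σ-ones zero f h = refl
Σ-ones (suc k) f h = cong₂ _+_ (h 0 (s≤s z≤n)) (Σ-ones k _ (λ t t<k → h (suc t) (s≤s t<k)))

Σ-atLeastOnes : ∀ k (f : ℕ → ℕ) → (∀ t → t < k → 1 ≤ f t) → k ≤ Σ< k f
Σ-atLeastOnes zero f h = z≤n
Σ-atLeastOnes (suc k) f h =
  +-mono-≤ (h 0 (s≤s z≤n)) (Σ-atLeastOnes k (λ t → f (suc t)) (λ t t<k → h (suc t) (s≤s t<k)))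

Σ-atLeastOnesBut : ∀ k (f : ℕ → ℕ) c → c < k → (∀ t → t < k → t ≢ c → 1 ≤ f t) → k ∸ 1 ≤ Σ< k f
Σ-atLeastOnesBut (suc k) f zero _ h =
  ≤-trans (Σ-atLeastOnes k (λ t → f (suc t)) (λ t t<k → h (suc t) (s≤s t<k) (λ ()))) (m≤n+m _ (f 0))
Σ-atLeastOnesBut (suc (suc k)) f (suc c) (s≤s c<k) h =
  +-mono-≤ (h 0 (s≤s z≤n) (λ ()))
    (Σ-atLeastOnesBut (suc k) (λ t → f (suc t)) c c<k (λ t t<k t≢c → h (suc t) (s≤s t<k) (λ e → t≢c (suc-injective e))))
Σ-atLeastOnesBut (suc zero) f (suc c) (s≤s ()) h

Σ² : ℕ → ℕ → (ℕ → ℕ → ℕ) → ℕ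
Σ² m n F = Σ< m (λ i → Σ< n (λ j → F i j))

Σ²-+ : ∀ m n F G → Σ² m n (λ i j → F i j + G i j) ≡ Σ² m n F + Σ² m n G
Σ²-+ m n F G = trans (Σ-cong m (λ i _ → Σ-+ n (F i) (G i))) (Σ-+ m (λ i → Σ< n (F i)) (λ i → Σ< n (G i)))

Σ²-mono : ∀ m n F G → (∀ i j → i < m → j < n → F i j ≤ G i j) → Σ² m n F ≤ Σ² m n G
Σ²-mono m n F G h = Σ-mono m (λ i i<m → Σ-mono n (λ j j<n → h i j i<m j<n))

Periodic : {A : Set} → ℕ → (ℕ → A) → Set
Periodic L g = ∀ t → g (t + L) ≡ g t

periodic-mult : ∀ {A : Set} (g : ℕ → A) L → Periodic L g → ∀ k t → g (t + k * L) ≡ g t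
periodic-mult g L per zero t = cong g (+-identityʳ t)
periodic-mult g L per (suc k) t =
  trans (cong g (sym (+-assoc t L (k * L)))) (trans (periodic-mult g L per k (t + L)) (per t))

periodic-mod : ∀ {A : Set} (g : ℕ → A) L .{{_ : NonZero L}} → Periodic L g → ∀ t → g t ≡ g (t % L)
periodic-mod g L per t = trans (cong g (m≡m%n+[m/n]*n t L)) (periodic-mult g L per (t / L) (t % L))

Σ-rotate : ∀ k (f : ℕ → ℕ) → Periodic k f → ∀ r → Σ< k (λ t → f (r + t)) ≡ Σ< k f
Σ-rotate k f per zero = refl
Σ-rotate k f per (suc r) =
  trans (Σ-cong k (λ t _ → cong f (sym (+-suc r t))))
   (trans (rotateOnce (λ t → f (r + t)) (trans (per r) (cong f (sym (+-identityʳ r)))))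
     (Σ-rotate k f per r))
  where
  rotateOnce : ∀ (g : ℕ → ℕ) → g k ≡ g 0 → Σ< k (λ t → g (suc t)) ≡ Σ< k g
  rotateOnce g e = +-cancelˡ-≡ (g 0) _ _ (trans (Σ-snoc k g) (trans (cong (Σ< k g +_) e) (+-comm _ (g 0))))

Σ-shift : ∀ k (f : ℕ → ℕ) → Periodic k f → Σ< k (λ t → f (suc t)) ≡ Σ< k f
Σ-shift k f per = Σ-rotate k f per 1

argmin : ℕ → (ℕ → ℕ) → ℕ
argmin zero g = 0
argmin (suc k) g = if g (suc k) <ᵇ g (argmin k g) then suc k else argmin k g

argmin-≤ : ∀ k (g : ℕ → ℕ) → argmin k g ≤ k
argmin-≤ zero g = z≤n
argmin-≤ (suc k) g with g (suc k) <ᵇ g (argmin k g)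
... | true = ≤-refl
... | false = m≤n⇒m≤1+n (argmin-≤ k g)

argmin-min : ∀ k (g : ℕ → ℕ) j → j ≤ k → g (argmin k g) ≤ g j
argmin-min zero g .zero z≤n = ≤-refl
argmin-min (suc k) g j h with g (suc k) <ᵇ g (argmin k g) in eq | m≤n⇒m<n∨m≡n h
... | true  | inj₂ refl = ≤-refl
... | true  | inj₁ (s≤s h') =
  ≤-trans (<⇒≤ (<ᵇ⇒< (g (suc k)) (g (argmin k g)) (subst T (sym eq) tt))) (argmin-min k g j h')
... | false | inj₂ refl = ≮⇒≥ (λ (p : g (suc k) < g (argmin k g)) → subst T eq (<⇒<ᵇ p))
... | false | inj₁ (s≤s h') = argmin-min k g j h'

argmin-cong : ∀ k (g h : ℕ → ℕ) → (∀ j → g j ≡ h j) → argmin k g ≡ argmin k h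
argmin-cong zero g h e = refl
argmin-cong (suc k) g h e rewrite argmin-cong k g h e | e (suc k) | e (argmin k h) = refl

argmax : ℕ → (ℕ → ℕ) → ℕ
argmax zero g = 0
argmax (suc k) g = if g (argmax k g) <ᵇ g (suc k) then suc k else argmax k g

argmax-≤ : ∀ k (g : ℕ → ℕ) → argmax k g ≤ k
argmax-≤ zero g = z≤n
argmax-≤ (suc k) g with g (argmax k g) <ᵇ g (suc k)
... | true = ≤-refl
... | false = m≤n⇒m≤1+n (argmax-≤ k g)

argmax-max : ∀ k (g : ℕ → ℕ) j → j ≤ k → g j ≤ g (argmax k g)
argmax-max zero g .zero z≤n = ≤-refl
argmax-max (suc k) g j h with g (argmax k g) <ᵇ g (suc k) in eq | m≤n⇒m<n∨m≡n h
... | true  | inj₂ refl = ≤-refl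
... | true  | inj₁ (s≤s h') =
  ≤-trans (argmax-max k g j h') (<⇒≤ (<ᵇ⇒< (g (argmax k g)) (g (suc k)) (subst T (sym eq) tt)))
... | false | inj₂ refl = ≮⇒≥ (λ (p : g (argmax k g) < g (suc k)) → subst T eq (<⇒<ᵇ p))
... | false | inj₁ (s≤s h') = argmax-max k g j h'

exits : ℕ → (ℕ → Bool) → ℕ
exits L x = Σ< L (λ t → ι (x t ∧ not (x (suc t))))

findDrop : ∀ (x : ℕ → Bool) j₀ k → x j₀ ≡ true → x (j₀ + k) ≡ false →
           ∃ λ t → x (j₀ + t) ≡ true × x (suc (j₀ + t)) ≡ false
findDrop x j₀ zero e₁ e₂ rewrite +-identityʳ j₀ with trans (sym e₁) e₂
... | ()
findDrop x j₀ (suc k) e₁ e₂ with x (j₀ + k) in eq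
... | true = k , eq , trans (cong x (sym (+-suc j₀ k))) e₂
... | false = findDrop x j₀ k e₁ eq

periodicExit : ∀ L' (x : ℕ → Bool) → Periodic (suc L') x → ∀ j₀ j₁ → x j₀ ≡ true → x j₁ ≡ false →
               1 ≤ exits (suc L') x
periodicExit L' x per j₀ j₁ e₀ e₁ with findDrop x j₀ (j₁ + j₀ * L') e₀ falseLater
  where
  falseLater : x (j₀ + (j₁ + j₀ * L')) ≡ false
  falseLater = trans (cong x (rearrange j₀ j₁ L')) (trans (periodic-mult x (suc L') per j₀ j₁) e₁)
    where
    rearrange : ∀ a b c → a + (b + a * c) ≡ b + a * suc c
    rearrange = solve-∀
... | t , et , ef =
  ≤-trans (≤-reflexive (sym exitAt)) (Σ-term L (λ t → ι (x t ∧ not (x (suc t)))) (u % L) (m%n<n u L))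
  where
  L u : ℕ
  L = suc L'
  u = j₀ + t
  trueAt : x (u % L) ≡ true
  trueAt = trans (sym (periodic-mod x L per u)) et
  suc-mod : suc (u % L) % L ≡ suc u % L
  suc-mod = trans (%-distribˡ-+ 1 (u % L) L)
              (trans (cong (λ z → (1 % L + z) % L) (m%n%n≡m%n u L)) (sym (%-distribˡ-+ 1 u L)))
  falseAfter : x (suc (u % L)) ≡ false
  falseAfter = trans (periodic-mod x L per (suc (u % L)))
                 (trans (cong x suc-mod) (trans (sym (periodic-mod x L per (suc u))) ef))
  exitAt : ι (x (u % L) ∧ not (x (suc (u % L)))) ≡ 1
  exitAt rewrite trueAt | falseAfter = refl

two≤∸+ : ∀ x → 2 ≤ (2 ∸ x) + x
two≤∸+ x = ≤-trans (m≤n+m∸n 2 x) (≤-reflexive (+-comm x (2 ∸ x)))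

∸-triangle : ∀ a b c → a ∸ c ≤ (a ∸ b) + (b ∸ c)
∸-triangle a b c =
  m≤n+o⇒m∸n≤o a c (≤-trans (m≤n+m∸n a b) (≤-trans (+-monoˡ-≤ (a ∸ b) (m≤n+m∸n b c)) (≤-reflexive (regroup c (b ∸ c) (a ∸ b)))))
  where
  regroup : ∀ x y z → x + y + z ≡ x + (z + y)
  regroup = solve-∀

+-∸-≤ : ∀ x z k → x + z ∸ k ≤ x + (z ∸ k)
+-∸-≤ x z k = m≤n+o⇒m∸n≤o (x + z) k (≤-trans (+-monoʳ-≤ x (m≤n+m∸n z k)) (≤-reflexive (x∙yz≈y∙xz x k (z ∸ k))))

-- If a row holds a cells of a set, the next row a' cells, and d cells of the
-- first row lie above cells outside the set (so a ≤ d + a'), then the drop of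
-- (a − 1)⁺, plus 1 when the next row is empty but this one is not, is ≤ d.
rowDescent : ∀ a a' d → a ≤ d + a' → (a ∸ 1) ∸ (a' ∸ 1) + ι (not (a ≡ᵇ 0) ∧ (a' ≡ᵇ 0)) ≤ d
rowDescent zero zero d h = z≤n
rowDescent (suc a) zero d h = ≤-trans (≤-reflexive (+-comm a 1)) (subst (suc a ≤_) (+-identityʳ d) h)
rowDescent zero (suc a') d h rewrite 0∸n≡0 a' = z≤n
rowDescent (suc a) (suc a') d h rewrite +-identityʳ (a ∸ a') =
  m≤n+o⇒m∸n≤o a a' (≤-pred (subst (suc a ≤_) (trans (+-suc d a') (cong suc (+-comm d a'))) h))

-- An edge xy with both ends below θ is counted at most once when each end
-- below θ counts its neighbours with smaller label; other edges not at all.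
edgeCountedOnce : ∀ x y θ → ι (y <ᵇ θ) * less x y + ι (x <ᵇ θ) * less y x ≤ ι ((x <ᵇ θ) ∧ (y <ᵇ θ))
edgeCountedOnce x y θ with x <ᵇ θ in ex | y <ᵇ θ in ey
... | true | true rewrite +-identityʳ (less x y) | +-identityʳ (less y x) = less-asym x y
... | true | false rewrite less-0 {y} {x} (<⇒≤ (<-≤-trans (<ᵇ⇒< x θ (subst T (sym ex) tt)) (≮⇒≥ (λ p → subst T ey (<⇒<ᵇ p))))) = z≤n
... | false | true rewrite less-0 {x} {y} (<⇒≤ (<-≤-trans (<ᵇ⇒< y θ (subst T (sym ey) tt)) (≮⇒≥ (λ p → subst T ex (<⇒<ᵇ p))))) = z≤n
... | false | false = z≤n

-- Consecutive rows with emptiness flags b, b' and row minima x, y: the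
-- comparisons charged to empty rows (y < x if the first row is empty, x < y if
-- the second is) total at most [b] + [¬ b ∧ b'].
edgeAtEmptyRows : ∀ (b b' : Bool) x y → ι b' * less x y + ι b * less y x ≤ ι b + ι (not b ∧ b')
edgeAtEmptyRows true b' x y = ≤-trans (+-mono-≤ (ι-*-≤ b' (less x y)) (≤-reflexive (+-identityʳ (less y x)))) (less-asym x y)
edgeAtEmptyRows false true x y = ≤-trans (≤-reflexive (trans (+-identityʳ _) (+-identityʳ _))) (less-≤1 x y)
edgeAtEmptyRows false false x y = z≤n

-- A labelling Q of the discrete torus ℤ_m × ℤ_n (m = 1 + m', n = 1 + n'),
-- given as a doubly periodic function on ℕ × ℕ.  The neighbours of (i,j) are
-- (i, j−1), (i, j+1), (i−1, j), (i+1, j), with j − 1 written j + n' and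
-- i − 1 written i + m'.
module Torus (m' n' : ℕ) (Q : ℕ → ℕ → ℕ)
  (perI : ∀ i j → Q (i + suc m') j ≡ Q i j)
  (perJ : ∀ i j → Q i (j + suc n') ≡ Q i j) where

  m n : ℕ
  m = suc m'
  n = suc n'

  lower : ℕ → ℕ → ℕ
  lower i j = less (Q i (j + n')) (Q i j) + less (Q i (suc j)) (Q i j)
            + less (Q (i + m') j) (Q i j) + less (Q (suc i) j) (Q i j)

  deficit : ℕ → ℕ → ℕ
  deficit i j = 2 ∸ lower i j

  totalDeficit : ℕ
  totalDeficit = Σ² m n deficit

  -- The upper neighbour (i + 1) + m' of row i + 1 is row i + m, i.e. row i.
  pred-m : ∀ i → suc i + m' ≡ i + m
  pred-m i = sym (+-suc i m')

  -- Likewise the left neighbour of column j + 1 is column j + n.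
  pred-n : ∀ j → suc j + n' ≡ j + n
  pred-n j = sym (+-suc j n')

  rowMinPos : ℕ → ℕ
  rowMinPos i = argmin n' (Q i)

  rowMin : ℕ → ℕ
  rowMin i = Q i (rowMinPos i)

  rowMinPos<n : ∀ i → rowMinPos i < n
  rowMinPos<n i = s≤s (argmin-≤ n' (Q i))

  rowMin-≤ : ∀ i j → rowMin i ≤ Q i j
  rowMin-≤ i j = subst (rowMin i ≤_) (sym (periodic-mod (Q i) n (perJ i) j))
                   (argmin-min n' (Q i) (j % n) (≤-pred (m%n<n j n)))

  rowMin-periodic : Periodic m rowMin
  rowMin-periodic i = trans (cong (Q (i + m)) (argmin-cong n' (Q (i + m)) (Q i) (perI i))) (perI i (rowMinPos i))

  lowerAtRowMin : ∀ i → lower i (rowMinPos i) ≤ less (rowMin (i + m')) (rowMin i) + less (rowMin (suc i)) (rowMin i)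
  lowerAtRowMin i =
    ≤-trans (≤-reflexive (cong₂ (λ u v → u + v + less (Q (i + m') (rowMinPos i)) (rowMin i) + less (Q (suc i) (rowMinPos i)) (rowMin i))
                           (less-0 (rowMin-≤ i (rowMinPos i + n'))) (less-0 (rowMin-≤ i (suc (rowMinPos i))))))
            (+-mono-≤ (less-antitone {b = rowMin i} (rowMin-≤ (i + m') (rowMinPos i)))
                      (less-antitone {b = rowMin i} (rowMin-≤ (suc i) (rowMinPos i))))

  -- The threshold argument.  Row r has its unique maximum θ at column c, and
  -- every row and every column contains a label ≥ θ.  Let S = {(i,j) : Q i j < θ}.
  module Threshold (r c : ℕ) (r<m : r < m) (c<n : c < n)
    (c-max    : ∀ j → j < n → Q r j ≤ Q r c)
    (c-unique : ∀ j → j < n → Q r j ≡ Q r c → j ≡ c)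
    (rowsReach : ∀ i → i < m → ∃ λ j → j < n × Q r c ≤ Q i j)
    (colsReach : ∀ j → j < n → ∃ λ i → i < m × Q r c ≤ Q i j) where

    θ : ℕ
    θ = Q r c

    inS : ℕ → ℕ → Bool
    inS i j = Q i j <ᵇ θ

    σ : ℕ → ℕ → ℕ
    σ i j = ι (inS i j)

    inS-periodicI : ∀ i j → inS (i + m) j ≡ inS i j
    inS-periodicI i j = cong (_<ᵇ θ) (perI i j)

    inS-periodicJ : ∀ i j → inS i (j + n) ≡ inS i j
    inS-periodicJ i j = cong (_<ᵇ θ) (perJ i j)

    inS-true : ∀ {i j} → Q i j < θ → inS i j ≡ true
    inS-true {i} {j} h with Q i j <ᵇ θ in eq
    ... | true = refl
    ... | false = ⊥-elim (subst T eq (<⇒<ᵇ h))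

    inS-false : ∀ {i j} → θ ≤ Q i j → inS i j ≡ false
    inS-false {i} {j} h with Q i j <ᵇ θ in eq
    ... | true = ⊥-elim (<⇒≱ (<ᵇ⇒< (Q i j) θ (subst T (sym eq) tt)) h)
    ... | false = refl

    rowInS : ∀ j → j < n → j ≢ c → inS r j ≡ true
    rowInS j j<n j≢c = inS-true (≤∧≢⇒< (c-max j j<n) (λ e → j≢c (c-unique j j<n e)))

    rowSize : ℕ → ℕ
    rowSize i = Σ< n (σ i)

    empty : ℕ → Bool
    empty i = rowSize i ≡ᵇ 0

    rowSize-periodic : ∀ i → rowSize (i + m) ≡ rowSize i
    rowSize-periodic i = Σ-cong n (λ j _ → cong ι (inS-periodicI i j))

    empty-periodic : ∀ i → ι (empty (i + m)) ≡ ι (empty i)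
    empty-periodic i = cong (λ z → ι (z ≡ᵇ 0)) (rowSize-periodic i)

    size rightInside rightExits downInside downExits : ℕ
    size        = Σ² m n σ
    rightInside = Σ² m n (λ i j → ι (inS i j ∧ inS i (suc j)))
    rightExits  = Σ² m n (λ i j → ι (inS i j ∧ not (inS i (suc j))))
    downInside  = Σ² m n (λ i j → ι (inS i j ∧ inS (suc i) j))
    downExits   = Σ² m n (λ i j → ι (inS i j ∧ not (inS (suc i) j)))

    size-right : size ≡ rightInside + rightExits
    size-right = trans (Σ-cong m (λ i _ → Σ-cong n (λ j _ → ι-split (inS i j) (inS i (suc j)))))
                       (Σ²-+ m n (λ i j → ι (inS i j ∧ inS i (suc j))) (λ i j → ι (inS i j ∧ not (inS i (suc j)))))

    size-down : size ≡ downInside + downExits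
    size-down = trans (Σ-cong m (λ i _ → Σ-cong n (λ j _ → ι-split (inS i j) (inS (suc i) j))))
                      (Σ²-+ m n (λ i j → ι (inS i j ∧ inS (suc i) j)) (λ i j → ι (inS i j ∧ not (inS (suc i) j))))

    lowerLeft lowerRight lowerUp lowerDown : ℕ → ℕ → ℕ
    lowerLeft  i j = less (Q i (j + n')) (Q i j)
    lowerRight i j = less (Q i (suc j)) (Q i j)
    lowerUp    i j = less (Q (i + m') j) (Q i j)
    lowerDown  i j = less (Q (suc i) j) (Q i j)

    deficitOnS leftOnS rightOnS upOnS downOnS : ℕ
    deficitOnS = Σ² m n (λ i j → σ i j * deficit i j)
    leftOnS    = Σ² m n (λ i j → σ i j * lowerLeft i j)
    rightOnS   = Σ² m n (λ i j → σ i j * lowerRight i j)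
    upOnS      = Σ² m n (λ i j → σ i j * lowerUp i j)
    downOnS    = Σ² m n (λ i j → σ i j * lowerDown i j)

    -- Every vertex of S has 2 ≤ deficit + number of lower neighbours.
    twiceSize : size + size ≤ deficitOnS + leftOnS + rightOnS + upOnS + downOnS
    twiceSize = ≤-trans (≤-reflexive (sym doubled)) (≤-trans (Σ²-mono m n (λ i j → σ i j * 2) _ (λ i j _ _ → atVertex i j)) (≤-reflexive split))
      where
      atVertex : ∀ i j → σ i j * 2 ≤ σ i j * deficit i j + σ i j * lowerLeft i j + σ i j * lowerRight i j
                                       + σ i j * lowerUp i j + σ i j * lowerDown i j
      atVertex i j = ≤-trans (*-monoʳ-≤ (σ i j) (two≤∸+ (lower i j)))
                       (≤-reflexive (distrib (σ i j) (deficit i j) (lowerLeft i j) (lowerRight i j) (lowerUp i j) (lowerDown i j)))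
        where
        distrib : ∀ s x a b c d → s * (x + (a + b + c + d)) ≡ s * x + s * a + s * b + s * c + s * d
        distrib = solve-∀
      doubled : Σ² m n (λ i j → σ i j * 2) ≡ size + size
      doubled = trans (Σ-cong m (λ i _ → Σ-cong n (λ j _ → trans (*-comm (σ i j) 2) (cong (σ i j +_) (+-identityʳ (σ i j))))))
                      (Σ²-+ m n σ σ)
      split : Σ² m n (λ i j → σ i j * deficit i j + σ i j * lowerLeft i j + σ i j * lowerRight i j + σ i j * lowerUp i j + σ i j * lowerDown i j)
              ≡ deficitOnS + leftOnS + rightOnS + upOnS + downOnS
      split = trans (Σ²-+ m n (λ i j → d i j + l i j + r' i j + u i j) (λ i j → σ i j * lowerDown i j))
               (cong (_+ downOnS) (trans (Σ²-+ m n (λ i j → d i j + l i j + r' i j) u)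
                 (cong (_+ upOnS) (trans (Σ²-+ m n (λ i j → d i j + l i j) r')
                   (cong (_+ rightOnS) (Σ²-+ m n d l))))))
        where
        d l r' u : ℕ → ℕ → ℕ
        d  i j = σ i j * deficit i j
        l  i j = σ i j * lowerLeft i j
        r' i j = σ i j * lowerRight i j
        u  i j = σ i j * lowerUp i j

    -- Re-indexing by periodicity: the left comparison at (i,j+1) is the right
    -- comparison seen from (i,j), and likewise vertically.
    leftOnS-shift : leftOnS ≡ Σ² m n (λ i j → σ i (suc j) * less (Q i j) (Q i (suc j)))
    leftOnS-shift = Σ-cong m (λ i _ → sym (trans
                      (Σ-cong n (λ j _ → cong (λ z → σ i (suc j) * less z (Q i (suc j))) (sym (trans (cong (Q i) (pred-n j)) (perJ i j)))))
                      (Σ-shift n (λ j → σ i j * lowerLeft i j) (periodic i))))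
      where
      periodic : ∀ i → Periodic n (λ j → σ i j * lowerLeft i j)
      periodic i t = cong₂ _*_ (cong ι (inS-periodicJ i t))
                       (cong₂ less (trans (cong (Q i) (xy∙z≈xz∙y t n n')) (perJ i (t + n'))) (perJ i t))

    upOnS-shift : upOnS ≡ Σ² m n (λ i j → σ (suc i) j * less (Q i j) (Q (suc i) j))
    upOnS-shift = sym (trans (Σ-cong m (λ i _ → Σ-cong n (λ j _ → cong (λ z → σ (suc i) j * less z (Q (suc i) j))
                                (sym (trans (cong (λ z → Q z j) (pred-m i)) (perI i j))))))
                             (Σ-shift m (λ i → Σ< n (λ j → σ i j * lowerUp i j)) periodic))
      where
      periodic : Periodic m (λ i → Σ< n (λ j → σ i j * lowerUp i j))
      periodic t = Σ-cong n (λ j _ → cong₂ _*_ (cong ι (inS-periodicI t j))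
                     (cong₂ less (trans (cong (λ z → Q z j) (xy∙z≈xz∙y t m m')) (perI (t + m') j)) (perI t j)))

    -- An edge inside S is seen as a lower neighbour from at most one end.
    horizontalInside : leftOnS + rightOnS ≤ rightInside
    horizontalInside =
      ≤-trans (≤-reflexive (cong (_+ rightOnS) leftOnS-shift))
        (≤-trans (≤-reflexive (sym (Σ²-+ m n (λ i j → σ i (suc j) * less (Q i j) (Q i (suc j))) (λ i j → σ i j * lowerRight i j))))
          (Σ²-mono m n _ _ (λ i j _ _ → edgeCountedOnce (Q i j) (Q i (suc j)) θ)))

    verticalInside : upOnS + downOnS ≤ downInside
    verticalInside =
      ≤-trans (≤-reflexive (cong (_+ downOnS) upOnS-shift))
        (≤-trans (≤-reflexive (sym (Σ²-+ m n (λ i j → σ (suc i) j * less (Q i j) (Q (suc i) j)) (λ i j → σ i j * lowerDown i j))))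
          (Σ²-mono m n _ _ (λ i j _ _ → edgeCountedOnce (Q i j) (Q (suc i) j) θ)))

    exitsBound : rightExits + downExits ≤ deficitOnS
    exitsBound = +-cancelˡ-≤ (rightInside + downInside) (rightExits + downExits) deficitOnS (begin
      rightInside + downInside + (rightExits + downExits)
        ≡⟨ interchange rightInside downInside rightExits downExits ⟩
      (rightInside + rightExits) + (downInside + downExits)
        ≡⟨ cong₂ _+_ (sym size-right) (sym size-down) ⟩
      size + size
        ≤⟨ twiceSize ⟩
      deficitOnS + leftOnS + rightOnS + upOnS + downOnS
        ≡⟨ regroup deficitOnS leftOnS rightOnS upOnS downOnS ⟩
      deficitOnS + ((leftOnS + rightOnS) + (upOnS + downOnS))
        ≤⟨ +-monoʳ-≤ deficitOnS (+-mono-≤ horizontalInside verticalInside) ⟩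
      deficitOnS + (rightInside + downInside)
        ≡⟨ +-comm deficitOnS _ ⟩
      rightInside + downInside + deficitOnS ∎)
      where
      open ≤-Reasoning
      regroup : ∀ s a b c d → s + a + b + c + d ≡ s + ((a + b) + (c + d))
      regroup = solve-∀

    -- Rows missing S contribute their deficit at the row minimum, which lies
    -- outside S; this is disjoint from the deficit counted on S.
    E : ℕ → ℕ
    E i = ι (empty i)

    deficitAtEmptyRows : ℕ
    deficitAtEmptyRows = Σ< m (λ i → E i * deficit i (rowMinPos i))

    deficitSplit : deficitOnS + deficitAtEmptyRows ≤ totalDeficit
    deficitSplit = ≤-trans (≤-reflexive (sym (Σ-+ m (λ i → Σ< n (λ j → σ i j * deficit i j)) (λ i → E i * deficit i (rowMinPos i)))))
                           (Σ-mono m (λ i _ → inRow i))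
      where
      inRow : ∀ i → Σ< n (λ j → σ i j * deficit i j) + E i * deficit i (rowMinPos i) ≤ Σ< n (deficit i)
      inRow i with rowSize i ≟ 0
      ... | yes size0 rewrite size0 =
        ≤-trans (+-monoˡ-≤ _ (≤-trans (Σ-mono n (λ j j<n → ≤-reflexive (cong (_* deficit i j) (Σ-zeroAt n (σ i) size0 j j<n))))
                                        (≤-reflexive (Σ-zero n))))
          (≤-trans (≤-reflexive (+-identityʳ (deficit i (rowMinPos i)))) (Σ-term n (deficit i) (rowMinPos i) (rowMinPos<n i)))
      ... | no size≢0 with rowSize i ≡ᵇ 0 in eq
      ...   | true = ⊥-elim (size≢0 (≡ᵇ⇒≡ (rowSize i) 0 (subst T (sym eq) tt)))
      ...   | false = ≤-trans (≤-reflexive (+-identityʳ _)) (Σ-mono n (λ j _ → ι-*-≤ (inS i j) (deficit i j)))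

    nonEmptyRows emptyRows : ℕ
    nonEmptyRows = Σ< m (λ i → ι (not (empty i)))
    emptyRows = Σ< m E

    rows-split : nonEmptyRows + emptyRows ≡ m
    rows-split = trans (sym (Σ-+ m (λ i → ι (not (empty i))) E)) (Σ-ones m _ (λ i _ → ι-not (empty i)))

    -- A row meeting S also has a label ≥ θ, so it contains an exit to the right.
    nonEmptyRowsExit : nonEmptyRows ≤ rightExits
    nonEmptyRowsExit = Σ-mono m rowExit
      where
      rowExit : ∀ i → i < m → ι (not (empty i)) ≤ exits n (inS i)
      rowExit i i<m with rowSize i ≡ᵇ 0 in eq
      ... | true = z≤n
      ... | false with Σ-pos n (σ i) rowSize>0 | rowsReach i i<m
        where
        rowSize>0 : 0 < rowSize i
        rowSize>0 with rowSize i
        ... | zero = ⊥-elim (subst T eq tt)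
        ... | suc _ = s≤s z≤n
      ... | j₀ , _ , p₀ | j₁ , _ , q₁ = periodicExit n' (inS i) (inS-periodicJ i) j₀ j₁ (ι-pos (inS i j₀) p₀) (inS-false q₁)

    -- In each column j ≠ c, row r is in S and some label is ≥ θ, so the column
    -- contains a downward exit.
    columnsExit : n ∸ 1 ≤ downExits
    columnsExit = ≤-trans (Σ-atLeastOnesBut n _ c c<n columnExit)
                    (≤-reflexive (sym (Σ-swap m n (λ i j → ι (inS i j ∧ not (inS (suc i) j))))))
      where
      columnExit : ∀ j → j < n → j ≢ c → 1 ≤ exits m (λ i → inS i j)
      columnExit j j<n j≢c with colsReach j j<n
      ... | i₁ , _ , q₁ = periodicExit m' (λ i → inS i j) (λ t → inS-periodicI t j) r i₁ (rowInS j j<n j≢c) (inS-false q₁)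

    emptyStarts : ℕ
    emptyStarts = Σ< m (λ i → ι (not (empty i) ∧ empty (suc i)))

    upAtEmpty downAtEmpty : ℕ
    upAtEmpty   = Σ< m (λ i → E i * less (rowMin (i + m')) (rowMin i))
    downAtEmpty = Σ< m (λ i → E i * less (rowMin (suc i)) (rowMin i))

    upAtEmpty-shift : upAtEmpty ≡ Σ< m (λ i → E (suc i) * less (rowMin i) (rowMin (suc i)))
    upAtEmpty-shift = sym (trans (Σ-cong m (λ i _ → cong (λ z → E (suc i) * less z (rowMin (suc i)))
                                   (sym (trans (cong rowMin (pred-m i)) (rowMin-periodic i)))))
                                 (Σ-shift m (λ i → E i * less (rowMin (i + m')) (rowMin i)) periodic))
      where
      periodic : Periodic m (λ i → E i * less (rowMin (i + m')) (rowMin i))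
      periodic t = cong₂ _*_ (empty-periodic t)
                     (cong₂ less (trans (cong rowMin (xy∙z≈xz∙y t m m')) (rowMin-periodic (t + m'))) (rowMin-periodic t))

    -- An empty row has deficit ≥ 2 at its minimum unless a vertical neighbour of
    -- that minimum is smaller; such comparisons are paid for by emptyStarts.
    emptyRowsBound : emptyRows ≤ deficitAtEmptyRows + emptyStarts
    emptyRowsBound = +-cancelˡ-≤ emptyRows emptyRows (deficitAtEmptyRows + emptyStarts) (begin
      emptyRows + emptyRows
        ≡⟨ sym (trans (Σ-cong m (λ i _ → trans (*-comm (E i) 2) (cong (E i +_) (+-identityʳ (E i))))) (Σ-+ m E E)) ⟩
      Σ< m (λ i → E i * 2)
        ≤⟨ Σ-mono m (λ i _ → atEmptyRow i) ⟩
      Σ< m (λ i → E i * deficit i (rowMinPos i) + E i * less (rowMin (i + m')) (rowMin i) + E i * less (rowMin (suc i)) (rowMin i))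
        ≡⟨ trans (Σ-+ m (λ i → E i * deficit i (rowMinPos i) + E i * less (rowMin (i + m')) (rowMin i)) (λ i → E i * less (rowMin (suc i)) (rowMin i)))
                 (trans (cong (_+ downAtEmpty) (Σ-+ m (λ i → E i * deficit i (rowMinPos i)) (λ i → E i * less (rowMin (i + m')) (rowMin i))))
                        (+-assoc deficitAtEmptyRows upAtEmpty downAtEmpty)) ⟩
      deficitAtEmptyRows + (upAtEmpty + downAtEmpty)
        ≡⟨ cong (λ z → deficitAtEmptyRows + (z + downAtEmpty)) upAtEmpty-shift ⟩
      deficitAtEmptyRows + (Σ< m (λ i → E (suc i) * less (rowMin i) (rowMin (suc i))) + downAtEmpty)
        ≡⟨ cong (deficitAtEmptyRows +_) (sym (Σ-+ m (λ i → E (suc i) * less (rowMin i) (rowMin (suc i))) (λ i → E i * less (rowMin (suc i)) (rowMin i)))) ⟩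
      deficitAtEmptyRows + Σ< m (λ i → E (suc i) * less (rowMin i) (rowMin (suc i)) + E i * less (rowMin (suc i)) (rowMin i))
        ≤⟨ +-monoʳ-≤ deficitAtEmptyRows (Σ-mono m (λ i _ → edgeAtEmptyRows (empty i) (empty (suc i)) (rowMin i) (rowMin (suc i)))) ⟩
      deficitAtEmptyRows + Σ< m (λ i → E i + ι (not (empty i) ∧ empty (suc i)))
        ≡⟨ cong (deficitAtEmptyRows +_) (Σ-+ m E (λ i → ι (not (empty i) ∧ empty (suc i)))) ⟩
      deficitAtEmptyRows + (emptyRows + emptyStarts)
        ≡⟨ x∙yz≈y∙xz deficitAtEmptyRows emptyRows emptyStarts ⟩
      emptyRows + (deficitAtEmptyRows + emptyStarts) ∎)
      where
      open ≤-Reasoning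
      atEmptyRow : ∀ i → E i * 2 ≤ E i * deficit i (rowMinPos i) + E i * less (rowMin (i + m')) (rowMin i)
                                   + E i * less (rowMin (suc i)) (rowMin i)
      atEmptyRow i = ≤-trans (*-monoʳ-≤ (E i) (≤-trans (two≤∸+ (lower i (rowMinPos i))) (+-monoʳ-≤ (deficit i (rowMinPos i)) (lowerAtRowMin i))))
                       (≤-reflexive (distrib (E i) (deficit i (rowMinPos i)) _ _))
        where
        distrib : ∀ s x a b → s * (x + (a + b)) ≡ s * x + s * a + s * b
        distrib = solve-∀

    excess descent : ℕ → ℕ
    excess i = rowSize i ∸ 1
    descent i = excess i ∸ excess (suc i)

    descentTotal : ℕ
    descentTotal = Σ< m descent

    descent-periodic : Periodic m descent
    descent-periodic t = cong₂ _∸_ (cong (_∸ 1) (rowSize-periodic t)) (cong (_∸ 1) (rowSize-periodic (suc t)))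

    -- A cell of S above a cell outside S is a downward exit, so every row needs
    -- at least (descent of excess) + [row empties next] downward exits.
    descentBound : descentTotal + emptyStarts ≤ downExits
    descentBound = ≤-trans (≤-reflexive (sym (Σ-+ m descent (λ i → ι (not (empty i) ∧ empty (suc i))))))
                     (Σ-mono m {g = rowDownExits} (λ i _ → rowDescent (rowSize i) (rowSize (suc i)) (rowDownExits i) (rowSize-≤ i)))
      where
      rowDownExits : ℕ → ℕ
      rowDownExits i = Σ< n (λ j → ι (inS i j ∧ not (inS (suc i) j)))
      below : ∀ x y → ι x ≤ ι (x ∧ not y) + ι y
      below true true = s≤s z≤n
      below true false = s≤s z≤n
      below false y = z≤n
      rowSize-≤ : ∀ i → rowSize i ≤ rowDownExits i + rowSize (suc i)
      rowSize-≤ i = ≤-trans (Σ-mono n (λ j _ → below (inS i j) (inS (suc i) j)))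
                      (≤-reflexive (Σ-+ n (λ j → ι (inS i j ∧ not (inS (suc i) j))) (σ (suc i))))

    descentPath : ∀ k p → excess p ∸ excess (p + k) ≤ Σ< k (λ t → descent (p + t))
    descentPath zero p rewrite +-identityʳ p | n∸n≡0 (excess p) = z≤n
    descentPath (suc k) p =
      ≤-trans (∸-triangle (excess p) (excess (suc p)) (excess (p + suc k)))
        (+-mono-≤ (≤-reflexive (cong descent (sym (+-identityʳ p))))
          (≤-trans (≤-reflexive (cong (λ z → excess (suc p) ∸ excess z) (+-suc p k)))
            (≤-trans (descentPath k (suc p)) (≤-reflexive (Σ-cong k (λ t _ → cong descent (sym (+-suc p t))))))))

    -- Row r has excess ≥ n − 2; an empty row has excess 0; going around the
    -- torus from r to it the excess must descend by n − 2.
    descentToEmpty : ∀ q → q < m → rowSize q ≡ 0 → n ∸ 2 ≤ descentTotal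
    descentToEmpty q q<m size0 = ≤-trans excess-r (≤-trans (≤-reflexive (sym dropAll)) (pathFrom-r (r ≤? q)))
      where
      excess-r : n ∸ 2 ≤ excess r
      excess-r = ≤-trans (≤-reflexive (sym (∸-+-assoc n 1 1)))
                   (∸-monoˡ-≤ 1 (Σ-atLeastOnesBut n (σ r) c c<n (λ j j<n j≢c → ≤-reflexive (sym (cong ι (rowInS j j<n j≢c))))))
      dropAll : excess r ∸ excess q ≡ excess r
      dropAll rewrite size0 = refl
      pathFrom-r : Dec (r ≤ q) → excess r ∸ excess q ≤ descentTotal
      pathFrom-r (yes r≤q) =
        ≤-trans (≤-reflexive (cong (λ z → excess r ∸ excess z) (sym (m+[n∸m]≡n r≤q))))
          (≤-trans (descentPath (q ∸ r) r)
            (≤-trans (Σ-prefix (q ∸ r) m _ (≤-trans (m∸n≤m q r) (<⇒≤ q<m)))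
              (≤-reflexive (Σ-rotate m descent descent-periodic r))))
      pathFrom-r (no r≰q) =
        ≤-trans (≤-reflexive (cong (excess r ∸_) (sym wrapAround)))
          (≤-trans (descentPath (m + q ∸ r) r)
            (≤-trans (Σ-prefix (m + q ∸ r) m _ length≤m)
              (≤-reflexive (Σ-rotate m descent descent-periodic r))))
        where
        r≤m+q : r ≤ m + q
        r≤m+q = ≤-trans (<⇒≤ r<m) (m≤m+n m q)
        wrapAround : excess (r + (m + q ∸ r)) ≡ excess q
        wrapAround = trans (cong excess (m+[n∸m]≡n r≤m+q)) (trans (cong excess (+-comm m q)) (cong (_∸ 1) (rowSize-periodic q)))
        length≤m : m + q ∸ r ≤ m
        length≤m = m≤n+o⇒m∸n≤o (m + q) r (≤-trans (+-monoʳ-≤ m (<⇒≤ (≰⇒> r≰q))) (≤-reflexive (+-comm m r)))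

    -- If every row meets S: m ≤ rightExits and n − 1 ≤ downExits.
    boundWithoutEmptyRows : emptyRows ≡ 0 → m + n ∸ 2 ≤ totalDeficit
    boundWithoutEmptyRows noEmpty = begin
      m + n ∸ 2                  ≤⟨ +-∸-≤ m n 2 ⟩
      m + (n ∸ 2)                ≤⟨ +-mono-≤ (≤-reflexive (sym allRowsMeetS)) (≤-trans (∸-monoʳ-≤ n (s≤s (z≤n {1}))) columnsExit) ⟩
      nonEmptyRows + downExits   ≤⟨ +-monoˡ-≤ downExits nonEmptyRowsExit ⟩
      rightExits + downExits     ≤⟨ exitsBound ⟩
      deficitOnS                 ≤⟨ m≤m+n deficitOnS deficitAtEmptyRows ⟩
      deficitOnS + deficitAtEmptyRows ≤⟨ deficitSplit ⟩
      totalDeficit               ∎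
      where
      open ≤-Reasoning
      allRowsMeetS : nonEmptyRows ≡ m
      allRowsMeetS = trans (sym (+-identityʳ _)) (trans (cong (nonEmptyRows +_) (sym noEmpty)) rows-split)

    -- If row q misses S: the excess must descend by n − 2, and empty rows are
    -- paid for by their row minima.
    boundWithEmptyRow : ∀ q → q < m → rowSize q ≡ 0 → m + n ∸ 2 ≤ totalDeficit
    boundWithEmptyRow q q<m size0 = begin
      m + n ∸ 2                                                  ≤⟨ +-∸-≤ m n 2 ⟩
      m + (n ∸ 2)                                                ≤⟨ +-monoʳ-≤ m (descentToEmpty q q<m size0) ⟩
      m + descentTotal                                           ≤⟨ +-monoˡ-≤ descentTotal m≤ ⟩
      rightExits + emptyRows + descentTotal                      ≤⟨ +-monoˡ-≤ descentTotal (+-monoʳ-≤ rightExits emptyRowsBound) ⟩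
      rightExits + (deficitAtEmptyRows + emptyStarts) + descentTotal ≡⟨ regroup rightExits deficitAtEmptyRows emptyStarts descentTotal ⟩
      rightExits + (descentTotal + emptyStarts) + deficitAtEmptyRows ≤⟨ +-monoˡ-≤ deficitAtEmptyRows (+-monoʳ-≤ rightExits descentBound) ⟩
      rightExits + downExits + deficitAtEmptyRows                ≤⟨ +-monoˡ-≤ deficitAtEmptyRows exitsBound ⟩
      deficitOnS + deficitAtEmptyRows                            ≤⟨ deficitSplit ⟩
      totalDeficit                                               ∎
      where
      open ≤-Reasoning
      m≤ : m ≤ rightExits + emptyRows
      m≤ = ≤-trans (≤-reflexive (sym rows-split)) (+-monoˡ-≤ emptyRows nonEmptyRowsExit)
      regroup : ∀ x a b d → x + (a + b) + d ≡ x + (d + b) + a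
      regroup = solve-∀

    thresholdBound : m + n ∸ 2 ≤ totalDeficit
    thresholdBound with emptyRows ≟ 0
    ... | yes noEmpty = boundWithoutEmptyRows noEmpty
    ... | no someEmpty with Σ-pos m E (n≢0⇒n>0 someEmpty)
    ... | q , q<m , Eq>0 = boundWithEmptyRow q q<m (≡ᵇ⇒≡ (rowSize q) 0 (subst T (sym (ι-pos (empty q) Eq>0)) tt))

-- The torus inequality: an injective labelling of ℤ_m × ℤ_n has total deficit
-- at least m + n − 2.  Take the smallest row maximum and the smallest column
-- maximum; the threshold argument applies to the smaller one, directly for a
-- row and after transposing the torus for a column.
module TorusInequality (m' n' : ℕ) (Q : ℕ → ℕ → ℕ)
  (perI : ∀ i j → Q (i + suc m') j ≡ Q i j)
  (perJ : ∀ i j → Q i (j + suc n') ≡ Q i j)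
  (inj : ∀ i j i' j' → i < suc m' → j < suc n' → i' < suc m' → j' < suc n' → Q i j ≡ Q i' j' → i ≡ i' × j ≡ j') where

  open Torus m' n' Q perI perJ

  Qᵀ : ℕ → ℕ → ℕ
  Qᵀ j i = Q i j

  module Transposed = Torus n' m' Qᵀ (λ j i → perJ i j) (λ j i → perI i j)

  transpose-deficit : Transposed.totalDeficit ≡ totalDeficit
  transpose-deficit =
    trans (Σ-cong n (λ j _ → Σ-cong m (λ i _ → cong (2 ∸_)
            (reorder (less (Q (i + m') j) (Q i j)) (less (Q (suc i) j) (Q i j)) (less (Q i (j + n')) (Q i j)) (less (Q i (suc j)) (Q i j))))))
          (sym (Σ-swap m n deficit))
    where
    reorder : ∀ a b c d → a + b + c + d ≡ c + d + a + b
    reorder = solve-∀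

  rowMax colMax : ℕ → ℕ
  rowMax i = Q i (argmax n' (Q i))
  colMax j = Q (argmax m' (λ i → Q i j)) j

  r₀ c₀ : ℕ
  r₀ = argmin m' rowMax
  c₀ = argmin n' colMax

  r₀<m : r₀ < m
  r₀<m = s≤s (argmin-≤ m' rowMax)

  c₀<n : c₀ < n
  c₀<n = s≤s (argmin-≤ n' colMax)

  rowsReachRowMax : ∀ i → i < m → ∃ λ j → j < n × rowMax r₀ ≤ Q i j
  rowsReachRowMax i i<m = argmax n' (Q i) , s≤s (argmax-≤ n' (Q i)) , argmin-min m' rowMax i (≤-pred i<m)

  colsReachColMax : ∀ j → j < n → ∃ λ i → i < m × colMax c₀ ≤ Q i j
  colsReachColMax j j<n = argmax m' (λ i → Q i j) , s≤s (argmax-≤ m' (λ i → Q i j)) , argmin-min n' colMax j (≤-pred j<n)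

  torusBound : m + n ∸ 2 ≤ totalDeficit
  torusBound with rowMax r₀ ≤? colMax c₀
  ... | yes rowFirst = Threshold.thresholdBound r₀ c r₀<m c<n
          (λ j j<n → argmax-max n' (Q r₀) j (≤-pred j<n))
          (λ j j<n e → proj₂ (inj r₀ j r₀ c r₀<m j<n r₀<m c<n e))
          rowsReachRowMax
          (λ j j<n → let (i , i<m , le) = colsReachColMax j j<n in i , i<m , ≤-trans rowFirst le)
    where
    c : ℕ
    c = argmax n' (Q r₀)
    c<n : c < n
    c<n = s≤s (argmax-≤ n' (Q r₀))
  ... | no colFirst = subst₂ _≤_ (cong (_∸ 2) (+-comm n m)) transpose-deficit
          (Transposed.Threshold.thresholdBound c₀ r c₀<n r<m
            (λ i i<m → argmax-max m' (λ i → Q i c₀) i (≤-pred i<m))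
            (λ i i<m e → proj₁ (inj i c₀ r c₀ i<m c₀<n r<m c₀<n e))
            colsReachColMax
            (λ i i<m → let (j , j<n , le) = rowsReachRowMax i i<m in j , j<n , ≤-trans (<⇒≤ (≰⇒> colFirst)) le))
    where
    r : ℕ
    r = argmax m' (λ i → Q i c₀)
    r<m : r < m
    r<m = s≤s (argmax-≤ m' (λ i → Q i c₀))

maximum : List ℕ → ℕ
maximum = foldr _⊔_ 0

maximum-≥ : ∀ {A : Set} (h : A → ℕ) {u} {xs : List A} → u ∈ xs → h u ≤ maximum (map h xs)
maximum-≥ h (here refl) = m≤m⊔n _ _
maximum-≥ h {xs = x ∷ xs} (there p) = ≤-trans (maximum-≥ h p) (m≤n⊔m (h x) _)

maximum-witness : ∀ {A : Set} (h : A → ℕ) (xs : List A) t → t < maximum (map h xs) → ∃ λ u → u ∈ xs × t < h u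
maximum-witness h (x ∷ xs) t t< with ⊔-sel (h x) (maximum (map h xs))
... | inj₁ e = x , here refl , subst (t <_) e t<
... | inj₂ e with maximum-witness h xs t (subst (t <_) e t<)
... | u , u∈ , p = u , there u∈ , p

-- An acyclic relation `arc` on a finite type V (V injects into Fin N) admits an
-- injective height function increasing along arcs out of the listed vertices vs.
-- The height is (length of the longest arc path into v) · N + code of v; paths
-- have fewer than N arcs because a longer one repeats a vertex (pigeonhole),
-- which acyclicity forbids.
module TopologicalLabel {V : Set} (N' : ℕ) (code : V → Fin (suc N')) (code-injective : ∀ {u v} → code u ≡ code v → u ≡ v)
  (vs : List V) (arc : V → V → Bool) (acyclic : ∀ v → ¬ TransClosure (λ x y → T (arc x y)) v v) where

  N : ℕ
  N = suc N'

  Arc : V → V → Set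
  Arc x y = T (arc x y)

  -- depth k v: length of the longest path of at most k arcs ending at v.
  extend : (V → ℕ) → V → V → ℕ
  extend depthₖ v u = if arc u v then suc (depthₖ u) else 0

  depth : ℕ → V → ℕ
  depth zero v = 0
  depth (suc k) v = depth k v ⊔ maximum (map (extend (depth k) v) vs)

  extend-arc : ∀ (depthₖ : V → ℕ) {u v} → Arc u v → extend depthₖ v u ≡ suc (depthₖ u)
  extend-arc depthₖ {u} {v} a with arc u v
  ... | true = refl

  -- Path k v: a path of k arcs ending at v, followed backwards.
  data Path : ℕ → V → Set where
    nil  : ∀ {v} → Path 0 v
    cons : ∀ {k u v} → Arc u v → Path k u → Path (suc k) v

  vertexAt : ∀ {k v} → Path k v → Fin (suc k) → V
  vertexAt {v = v} p fzero = v
  vertexAt (cons _ p) (fsuc i) = vertexAt p i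

  path-reaches : ∀ {k v} (p : Path k v) (i j : Fin (suc k)) → toℕ i < toℕ j → TransClosure Arc (vertexAt p j) (vertexAt p i)
  path-reaches (cons a p) fzero (fsuc fzero) _ = [ a ]
  path-reaches (cons {k = suc k} a p) fzero (fsuc (fsuc j)) _ = path-reaches p fzero (fsuc j) (s≤s z≤n) ∷ʳ a
  path-reaches (cons a p) (fsuc i) (fsuc j) (s≤s h) = path-reaches p i j h

  noLongPath : ∀ {k v} → N < suc k → Path k v → ⊥
  noLongPath h p with pigeonhole h (λ i → code (vertexAt p i))
  ... | i , j , i<j , e = acyclic (vertexAt p j) (subst (TransClosure Arc (vertexAt p j)) (code-injective e) (path-reaches p i j i<j))

  deeperPath : ∀ k v → depth k v < depth (suc k) v → Path (suc k) v
  deeperPath k v h with ⊔-sel (depth k v) (maximum (map (extend (depth k) v) vs))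
  ... | inj₁ e = ⊥-elim (<-irrefl (sym e) h)
  ... | inj₂ e with maximum-witness (extend (depth k) v) vs (depth k v) (subst (depth k v <_) e h)
  ... | u , u∈ , p with arc u v in eq
  ... | false = ⊥-elim (n≮0 p)
  ... | true = cons a (shorter k p)
    where
    a : Arc u v
    a = subst T (sym eq) tt
    shorter : ∀ k → depth k v < suc (depth k u) → Path k u
    shorter zero _ = nil
    shorter (suc k) q = deeperPath k u (≤-pred (≤-trans (s≤s grows) q))
      where
      grows : suc (depth k u) ≤ depth (suc k) v
      grows = ≤-trans (≤-trans (≤-reflexive (sym (extend-arc (depth k) a))) (maximum-≥ (extend (depth k) v) u∈))
                      (m≤n⊔m (depth k v) _)

  depth-stable : ∀ v → depth (suc N) v ≤ depth N v
  depth-stable v with depth N v <? depth (suc N) v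
  ... | yes h = ⊥-elim (noLongPath (m≤n⇒m≤1+n ≤-refl) (deeperPath N v h))
  ... | no h = ≮⇒≥ h

  depth-arc : ∀ {u v} → u ∈ vs → Arc u v → depth N u < depth N v
  depth-arc {u} {v} u∈ a =
    ≤-trans (≤-trans (≤-reflexive (sym (extend-arc (depth N) a))) (≤-trans (maximum-≥ (extend (depth N) v) u∈) (m≤n⊔m (depth N v) _)))
            (depth-stable v)

  height : V → ℕ
  height v = depth N v * N + toℕ (code v)

  height-arc : ∀ {u v} → u ∈ vs → Arc u v → height u < height v
  height-arc {u} {v} u∈ a =
    ≤-trans (≤-trans (≤-reflexive (sym (+-suc (depth N u * N) (toℕ (code u))))) (+-monoʳ-≤ (depth N u * N) (toℕ<n (code u))))
      (≤-trans (≤-reflexive (+-comm (depth N u * N) N)) (≤-trans (*-monoˡ-≤ N (depth-arc u∈ a)) (m≤m+n (depth N v * N) _)))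

  height-injective : ∀ {u v} → height u ≡ height v → u ≡ v
  height-injective {u} {v} e = code-injective (toℕ-injective (trans (sym (height%N u)) (trans (cong (_% N) e) (height%N v))))
    where
    height%N : ∀ w → height w % N ≡ toℕ (code w)
    height%N w = trans (cong (_% N) (+-comm (depth N w * N) (toℕ (code w))))
                   (trans ([m+kn]%n≡m%n (toℕ (code w)) (depth N w) N) (m<n⇒m%n≡m (toℕ<n (code w))))

length-filter : ∀ {A : Set} (q : A → Bool) xs → length (filterᵇ q xs) ≡ sum (map (λ x → ι (q x)) xs)
length-filter q [] = refl
length-filter q (x ∷ xs) with q x
... | true = cong suc (length-filter q xs)
... | false = length-filter q xs

sum-cartesianProduct : ∀ {A B : Set} (h : A × B → ℕ) xs ys →
  sum (map h (cartesianProduct xs ys)) ≡ sum (map (λ x → sum (map (λ y → h (x , y)) ys)) xs)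
sum-cartesianProduct h [] ys = refl
sum-cartesianProduct h (x ∷ xs) ys = begin
  sum (map h (map (x ,_) ys ++ cartesianProduct xs ys))
    ≡⟨ cong sum (map-++ h (map (x ,_) ys) (cartesianProduct xs ys)) ⟩
  sum (map h (map (x ,_) ys) ++ map h (cartesianProduct xs ys))
    ≡⟨ sum-++ (map h (map (x ,_) ys)) (map h (cartesianProduct xs ys)) ⟩
  sum (map h (map (x ,_) ys)) + sum (map h (cartesianProduct xs ys))
    ≡⟨ cong₂ _+_ (cong sum (sym (map-∘ ys))) (sum-cartesianProduct h xs ys) ⟩
  sum (map (λ y → h (x , y)) ys) + sum (map (λ x → sum (map (λ y → h (x , y)) ys)) xs) ∎
  where open ≡-Reasoning

-- fin k i is the residue of i in Fin k; it identifies ℕ-indexed periodic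
-- functions with functions on Fin k.
fin : (k : ℕ) .{{_ : NonZero k}} → ℕ → Fin k
fin k i = fromℕ< (m%n<n i k)

toℕ-fin : ∀ k .{{_ : NonZero k}} i → toℕ (fin k i) ≡ i % k
toℕ-fin k i = toℕ-fromℕ< (m%n<n i k)

fin-toℕ : ∀ k .{{_ : NonZero k}} (x : Fin k) → fin k (toℕ x) ≡ x
fin-toℕ k x = trans (fromℕ<-cong (toℕ x % k) (toℕ x) (m<n⇒m%n≡m (toℕ<n x)) (m%n<n (toℕ x) k) (toℕ<n x)) (fromℕ<-toℕ x (toℕ<n x))

fin-mod : ∀ k .{{_ : NonZero k}} i → fin k (i % k) ≡ fin k i
fin-mod k i = fromℕ<-cong _ _ (m%n%n≡m%n i k) (m%n<n (i % k) k) (m%n<n i k)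

fin-+ : ∀ k .{{_ : NonZero k}} i → fin k (i + k) ≡ fin k i
fin-+ k i = fromℕ<-cong _ _ ([m+n]%n≡m%n i k) (m%n<n (i + k) k) (m%n<n i k)

toℕ-fin-< : ∀ k .{{_ : NonZero k}} i → i < k → toℕ (fin k i) ≡ i
toℕ-fin-< k i h = trans (toℕ-fin k i) (m<n⇒m%n≡m h)

toℕ-fin-related : ∀ k .{{_ : NonZero k}} (f : ℕ → ℕ) {a b} → a < k → b < k → toℕ (fin k a) ≡ f (toℕ (fin k b)) → a ≡ f b
toℕ-fin-related k f {a} {b} a<k b<k x = trans (sym (toℕ-fin-< k a a<k)) (trans x (cong f (toℕ-fin-< k b b<k)))

fin-injective-< : ∀ k .{{_ : NonZero k}} {a b} → a < k → b < k → fin k a ≡ fin k b → a ≡ b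
fin-injective-< k {a} {b} a<k b<k e = trans (sym (toℕ-fin-< k a a<k)) (trans (cong toℕ e) (toℕ-fin-< k b b<k))

sum-tabulate : ∀ {A : Set} k (g : Fin k → A) (h : A → ℕ) (H : ℕ → ℕ) → (∀ x → h (g x) ≡ H (toℕ x)) →
               sum (map h (tabulate g)) ≡ Σ< k H
sum-tabulate zero g h H e = refl
sum-tabulate (suc k) g h H e = cong₂ _+_ (e fzero) (sum-tabulate k (λ x → g (fsuc x)) h (λ t → H (suc t)) (λ x → e (fsuc x)))

sum-allFin : ∀ k .{{_ : NonZero k}} (h : Fin k → ℕ) → sum (map h (allFin k)) ≡ Σ< k (λ i → h (fin k i))
sum-allFin k h = sum-tabulate k (λ x → x) h (λ i → h (fin k i)) (λ x → cong h (sym (fin-toℕ k x)))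

module CycleArithmetic (c₀ : ℕ) where

  k' k : ℕ
  k' = suc (suc c₀)
  k = suc k'

  prev next : ℕ → ℕ
  prev y = (y + k') % k
  next y = suc y % k

  prev-0 : prev 0 ≡ k'
  prev-0 = m<n⇒m%n≡m {n = k} (n<1+n k')

  prev-suc : ∀ y → suc y < k → prev (suc y) ≡ y
  prev-suc y h = trans (cong (_% k) (sym (+-suc y k'))) (trans ([m+n]%n≡m%n y k) (m<n⇒m%n≡m (<-trans (n<1+n y) h)))

  next-< : ∀ y → suc y < k → next y ≡ suc y
  next-< y h = m<n⇒m%n≡m h

  next-last : ∀ y → suc y ≡ k → next y ≡ 0
  next-last y e = trans (cong (_% k) e) (n%n≡0 k)

  cycAdj-neighbours : (x y : Fin k) → CycAdj k x y → toℕ x ≡ prev (toℕ y) ⊎ toℕ x ≡ next (toℕ y)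
  cycAdj-neighbours x y (inj₁ e) rewrite sym e = inj₁ (sym (prev-suc (toℕ x) (subst (_< k) (sym e) (toℕ<n y))))
  cycAdj-neighbours x y (inj₂ (inj₁ e)) = inj₂ (sym (trans (next-< (toℕ y) (subst (_< k) (sym e) (toℕ<n x))) e))
  cycAdj-neighbours x y (inj₂ (inj₂ (inj₁ (e₁ , e₂)))) rewrite e₂ = inj₁ (trans (suc-injective e₁) (sym prev-0))
  cycAdj-neighbours x y (inj₂ (inj₂ (inj₂ (e₁ , e₂)))) = inj₂ (trans e₂ (sym (next-last (toℕ y) e₁)))

  cycAdj-prev : ∀ y → y < k → CycAdj k (fin k (y + k')) (fin k y)
  cycAdj-prev zero h = inj₂ (inj₂ (inj₁ (cong suc (trans (toℕ-fin k k') prev-0) , toℕ-fin k 0)))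
  cycAdj-prev (suc y) h = inj₁ (trans (cong suc (trans (toℕ-fin k (suc y + k')) (prev-suc y h))) (sym (toℕ-fin-< k (suc y) h)))

  cycAdj-next : ∀ y → y < k → CycAdj k (fin k (suc y)) (fin k y)
  cycAdj-next y h with m≤n⇒m<n∨m≡n h
  ... | inj₁ y+1<k = inj₂ (inj₁ (trans (cong suc (toℕ-fin-< k y h)) (sym (trans (toℕ-fin k (suc y)) (next-< y y+1<k)))))
  ... | inj₂ e = inj₂ (inj₂ (inj₂ (trans (cong suc (toℕ-fin-< k y h)) e , trans (toℕ-fin k (suc y)) (next-last y e))))

  -- Since k ≥ 3, y, prev y and next y are pairwise distinct.
  prev≢ : ∀ y → y < k → prev y ≢ y
  prev≢ zero h e with trans (sym prev-0) e
  ... | ()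
  prev≢ (suc y) h e = n≢1+n y (trans (sym (prev-suc y h)) e)
    where
    n≢1+n : ∀ n → n ≢ suc n
    n≢1+n n ()

  next≢ : ∀ y → y < k → next y ≢ y
  next≢ y h e with m≤n⇒m<n∨m≡n h
  ... | inj₁ y+1<k = 1+n≢n (trans (sym (next-< y y+1<k)) e)
  ... | inj₂ e' with trans (sym (next-last y e')) e | e'
  ... | refl | ()

  prev≢next : ∀ y → y < k → prev y ≢ next y
  prev≢next zero h e with trans (sym prev-0) (trans e (next-< 0 (s≤s (s≤s z≤n))))
  ... | ()
  prev≢next (suc y) h e with m≤n⇒m<n∨m≡n h
  ... | inj₁ y+2<k = n≢2+n y (trans (sym (prev-suc y h)) (trans e (next-< (suc y) y+2<k)))
    where
    n≢2+n : ∀ n → n ≢ suc (suc n)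
    n≢2+n n ()
  ... | inj₂ e' with trans (sym (prev-suc y h)) (trans e (next-last (suc y) e')) | e'
  ... | refl | ()

eqInd : ℕ → ℕ → ℕ
eqInd i a = ι (i ≡ᵇ a)

point : ℕ × ℕ → ℕ × ℕ → ℕ
point (i , j) (a , b) = eqInd i a * eqInd j b

eqInd-refl : ∀ a → eqInd a a ≡ 1
eqInd-refl zero = refl
eqInd-refl (suc a) = eqInd-refl a

point-refl : ∀ X → point X X ≡ 1
point-refl (a , b) rewrite eqInd-refl a | eqInd-refl b = refl

point-≢ : ∀ x X → x ≢ X → point x X ≡ 0
point-≢ (i , j) (a , b) x≢X with i ≡ᵇ a in e₁ | j ≡ᵇ b in e₂
... | false | _ = refl
... | true | false = *-zeroʳ 1
... | true | true = ⊥-elim (x≢X (cong₂ _,_ (≡ᵇ⇒≡ i a (subst T (sym e₁) tt)) (≡ᵇ⇒≡ j b (subst T (sym e₂) tt))))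

Σ-eqInd : ∀ k a c → a < k → Σ< k (λ t → eqInd t a * c) ≡ c
Σ-eqInd (suc k) zero c _ = trans (cong (c + 0 +_) (Σ-zero k)) (trans (+-identityʳ _) (+-identityʳ c))
Σ-eqInd (suc k) (suc a) c (s≤s h) = Σ-eqInd k a c h

Σ²-point : ∀ m n X c → proj₁ X < m → proj₂ X < n → Σ² m n (λ i j → point (i , j) X * c) ≡ c
Σ²-point m n (a , b) c a<m b<n =
  trans (Σ-cong m (λ i _ → trans (Σ-cong n (λ j _ → *-assoc (eqInd i a) (eqInd j b) c))
          (trans (Σ-* n (eqInd i a) (λ j → eqInd j b * c)) (cong (eqInd i a *_) (Σ-eqInd n b c b<n)))))
    (Σ-eqInd m a c a<m)

Σ²-fourPoints : ∀ m n (H : ℕ × ℕ → ℕ) (X₁ X₂ X₃ X₄ : ℕ × ℕ) →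
  proj₁ X₁ < m → proj₂ X₁ < n → proj₁ X₂ < m → proj₂ X₂ < n →
  proj₁ X₃ < m → proj₂ X₃ < n → proj₁ X₄ < m → proj₂ X₄ < n →
  X₁ ≢ X₂ → X₁ ≢ X₃ → X₁ ≢ X₄ → X₂ ≢ X₃ → X₂ ≢ X₄ → X₃ ≢ X₄ →
  (∀ i j → i < m → j < n → (i , j) ≢ X₁ → (i , j) ≢ X₂ → (i , j) ≢ X₃ → (i , j) ≢ X₄ → H (i , j) ≡ 0) →
  Σ² m n (λ i j → H (i , j)) ≡ H X₁ + H X₂ + H X₃ + H X₄
Σ²-fourPoints m n H X₁ X₂ X₃ X₄ a₁ b₁ a₂ b₂ a₃ b₃ a₄ b₄ d₁₂ d₁₃ d₁₄ d₂₃ d₂₄ d₃₄ vanish = begin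
  Σ² m n (λ i j → H (i , j))
    ≡⟨ Σ-cong m (λ i i<m → Σ-cong n (λ j j<n → decompose (i , j) (vanish i j i<m j<n))) ⟩
  Σ² m n (λ i j → P X₁ (i , j) + P X₂ (i , j) + P X₃ (i , j) + P X₄ (i , j))
    ≡⟨ trans (Σ²-+ m n (λ i j → P X₁ (i , j) + P X₂ (i , j) + P X₃ (i , j)) (λ i j → P X₄ (i , j)))
         (cong (_+ Σ² m n (λ i j → P X₄ (i , j))) (trans (Σ²-+ m n (λ i j → P X₁ (i , j) + P X₂ (i , j)) (λ i j → P X₃ (i , j)))
           (cong (_+ Σ² m n (λ i j → P X₃ (i , j))) (Σ²-+ m n (λ i j → P X₁ (i , j)) (λ i j → P X₂ (i , j)))))) ⟩
  Σ² m n (λ i j → P X₁ (i , j)) + Σ² m n (λ i j → P X₂ (i , j)) + Σ² m n (λ i j → P X₃ (i , j)) + Σ² m n (λ i j → P X₄ (i , j))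
    ≡⟨ cong₂ _+_ (cong₂ _+_ (cong₂ _+_ (Σ²-point m n X₁ (H X₁) a₁ b₁) (Σ²-point m n X₂ (H X₂) a₂ b₂))
                            (Σ²-point m n X₃ (H X₃) a₃ b₃)) (Σ²-point m n X₄ (H X₄) a₄ b₄) ⟩
  H X₁ + H X₂ + H X₃ + H X₄ ∎
  where
  open ≡-Reasoning
  P : ℕ × ℕ → ℕ × ℕ → ℕ
  P X x = point x X * H X
  _≟²_ : (x y : ℕ × ℕ) → Dec (x ≡ y)
  _≟²_ = ≡-dec _≟_ _≟_
  first : ∀ y a b c → y ≡ 1 * y + 0 * a + 0 * b + 0 * c
  first = solve-∀
  second : ∀ a y b c → y ≡ 0 * a + 1 * y + 0 * b + 0 * c
  second = solve-∀
  third : ∀ a b y c → y ≡ 0 * a + 0 * b + 1 * y + 0 * c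
  third = solve-∀
  fourth : ∀ a b c y → y ≡ 0 * a + 0 * b + 0 * c + 1 * y
  fourth = solve-∀
  decompose : ∀ x → (x ≢ X₁ → x ≢ X₂ → x ≢ X₃ → x ≢ X₄ → H x ≡ 0) → H x ≡ P X₁ x + P X₂ x + P X₃ x + P X₄ x
  decompose x z with x ≟² X₁ | x ≟² X₂ | x ≟² X₃ | x ≟² X₄
  ... | yes refl | _ | _ | _
    rewrite point-refl x | point-≢ x X₂ d₁₂ | point-≢ x X₃ d₁₃ | point-≢ x X₄ d₁₄ = first (H x) (H X₂) (H X₃) (H X₄)
  ... | no n₁ | yes refl | _ | _
    rewrite point-refl x | point-≢ x X₁ n₁ | point-≢ x X₃ d₂₃ | point-≢ x X₄ d₂₄ = second (H X₁) (H x) (H X₃) (H X₄)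
  ... | no n₁ | no n₂ | yes refl | _
    rewrite point-refl x | point-≢ x X₁ n₁ | point-≢ x X₂ n₂ | point-≢ x X₄ d₃₄ = third (H X₁) (H X₂) (H x) (H X₄)
  ... | no n₁ | no n₂ | no n₃ | yes refl
    rewrite point-refl x | point-≢ x X₁ n₁ | point-≢ x X₂ n₂ | point-≢ x X₃ n₃ = fourth (H X₁) (H X₂) (H X₃) (H x)
  ... | no n₁ | no n₂ | no n₃ | no n₄
    rewrite point-≢ x X₁ n₁ | point-≢ x X₂ n₂ | point-≢ x X₃ n₃ | point-≢ x X₄ n₄ = z n₁ n₂ n₃ n₄

degree4-excess : ∀ o x → o + x ≡ 4 → o ∸ x ≡ 2 * (2 ∸ x)
degree4-excess o x e = begin
  o ∸ x           ≡⟨ cong (_∸ x) (trans (sym (m+n∸n≡m o x)) (cong (_∸ x) e)) ⟩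
  4 ∸ x ∸ x       ≡⟨ ∸-+-assoc 4 x x ⟩
  4 ∸ (x + x)     ≡⟨ cong (4 ∸_) (cong (x +_) (sym (+-identityʳ x))) ⟩
  2 * 2 ∸ 2 * x   ≡⟨ sym (*-distribˡ-∸ 2 2 x) ⟩
  2 * (2 ∸ x)     ∎
  where open ≡-Reasoning

-- The torus C_m × C_n with m = 3 + a₀ and n = 3 + b₀; vertex (i mod m, j mod n)
-- is addressed by natural numbers i, j.
module TorusGraph (a₀ b₀ : ℕ) where

  module Cm = CycleArithmetic a₀
  module Cn = CycleArithmetic b₀

  m' n' m n : ℕ
  m' = suc (suc a₀)
  n' = suc (suc b₀)
  m = suc m'
  n = suc n'

  Vertex : Set
  Vertex = Fin m × Fin n

  vertices : List Vertex
  vertices = cartesianProduct (allFin m) (allFin n)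

  ∈-vertices : ∀ u → u ∈ vertices
  ∈-vertices (x , y) = ∈-cartesianProduct⁺ (∈-allFin x) (∈-allFin y)

  code : Vertex → Fin (m * n)
  code (x , y) = combine x y

  code-injective : ∀ {u v} → code u ≡ code v → u ≡ v
  code-injective {x , y} {x' , y'} e = trans (sym (remQuot-combine x y)) (trans (cong (remQuot n) e) (remQuot-combine x' y'))

  sum-vertices : (H : Vertex → ℕ) → sum (map H vertices) ≡ Σ² m n (λ i j → H (fin m i , fin n j))
  sum-vertices H = trans (sum-cartesianProduct H (allFin m) (allFin n))
                     (trans (sum-allFin m (λ x → sum (map (λ y → H (x , y)) (allFin n))))
                       (Σ-cong m (λ i _ → sum-allFin n (λ y → H (fin m i , y)))))

  module Oriented (hm : 3 ≤ m) (hn : 3 ≤ n) (arc : Vertex → Vertex → Bool)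
    (orientation : IsOrientation (Cycle m hm □ Cycle n hn) arc) (acyclic : Acyclic (Cycle m hm □ Cycle n hn) arc) where

    G : Graph
    G = Cycle m hm □ Cycle n hn

    open IsOrientation orientation

    open TopologicalLabel _ code code-injective vertices arc acyclic using (height; height-arc; height-injective)

    Q : ℕ → ℕ → ℕ
    Q i j = height (fin m i , fin n j)

    Q-periodicI : ∀ i j → Q (i + m) j ≡ Q i j
    Q-periodicI i j = cong (λ z → height (z , fin n j)) (fin-+ m i)

    Q-periodicJ : ∀ i j → Q i (j + n) ≡ Q i j
    Q-periodicJ i j = cong (λ z → height (fin m i , z)) (fin-+ n j)

    Q-injective : ∀ i j i' j' → i < m → j < n → i' < m → j' < n → Q i j ≡ Q i' j' → i ≡ i' × j ≡ j'
    Q-injective i j i' j' i<m j<n i'<m j'<n e with height-injective e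
    ... | same = fin-injective-< m i<m i'<m (cong proj₁ same) , fin-injective-< n j<n j'<n (cong proj₂ same)

    open TorusInequality m' n' Q Q-periodicI Q-periodicJ Q-injective using (torusBound)
    open Torus m' n' Q Q-periodicI Q-periodicJ using (lower; deficit; totalDeficit)

    module Neighbourhood (i j : ℕ) (i<m : i < m) (j<n : j < n) where

      v left right up down : Vertex
      v     = (fin m i , fin n j)
      left  = (fin m i , fin n (j + n'))
      right = (fin m i , fin n (suc j))
      up    = (fin m (i + m') , fin n j)
      down  = (fin m (suc i) , fin n j)

      leftAt rightAt upAt downAt : ℕ × ℕ
      leftAt  = (i , Cn.prev j)
      rightAt = (i , Cn.next j)
      upAt    = (Cm.prev i , j)
      downAt  = (Cm.next i , j)

      -- Since m, n ≥ 3 the four neighbours are distinct.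
      left≢right : leftAt ≢ rightAt
      left≢right e = Cn.prev≢next j j<n (cong proj₂ e)
      left≢up : leftAt ≢ upAt
      left≢up e = Cm.prev≢ i i<m (sym (cong proj₁ e))
      left≢down : leftAt ≢ downAt
      left≢down e = Cm.next≢ i i<m (sym (cong proj₁ e))
      right≢up : rightAt ≢ upAt
      right≢up e = Cm.prev≢ i i<m (sym (cong proj₁ e))
      right≢down : rightAt ≢ downAt
      right≢down e = Cm.next≢ i i<m (sym (cong proj₁ e))
      up≢down : upAt ≢ downAt
      up≢down e = Cm.prev≢next i i<m (cong proj₁ e)

      neighbours : ∀ i' j' → i' < m → j' < n → Adj G (fin m i' , fin n j') v →
                   (i' , j') ≡ leftAt ⊎ (i' , j') ≡ rightAt ⊎ (i' , j') ≡ upAt ⊎ (i' , j') ≡ downAt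
      neighbours i' j' i'<m j'<n (inj₁ (e , adj)) with Cn.cycAdj-neighbours (fin n j') (fin n j) adj
      ... | inj₁ x = inj₁ (cong₂ _,_ (fin-injective-< m i'<m i<m e) (toℕ-fin-related n Cn.prev j'<n j<n x))
      ... | inj₂ x = inj₂ (inj₁ (cong₂ _,_ (fin-injective-< m i'<m i<m e) (toℕ-fin-related n Cn.next j'<n j<n x)))
      neighbours i' j' i'<m j'<n (inj₂ (adj , e)) with Cm.cycAdj-neighbours (fin m i') (fin m i) adj
      ... | inj₁ x = inj₂ (inj₂ (inj₁ (cong₂ _,_ (toℕ-fin-related m Cm.prev i'<m i<m x) (fin-injective-< n j'<n j<n e))))
      ... | inj₂ x = inj₂ (inj₂ (inj₂ (cong₂ _,_ (toℕ-fin-related m Cm.next i'<m i<m x) (fin-injective-< n j'<n j<n e))))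

      sum-neighbours : (H : Vertex → ℕ) → (∀ u → ¬ Adj G u v → H u ≡ 0) →
                       sum (map H vertices) ≡ H left + H right + H up + H down
      sum-neighbours H vanish = begin
        sum (map H vertices)                          ≡⟨ sum-vertices H ⟩
        Σ² m n (λ x y → H′ (x , y))                   ≡⟨ Σ²-fourPoints m n H′ leftAt rightAt upAt downAt
                                                           i<m (m%n<n (j + n') n) i<m (m%n<n (suc j) n)
                                                           (m%n<n (i + m') m) j<n (m%n<n (suc i) m) j<n
                                                           left≢right left≢up left≢down right≢up right≢down up≢down
                                                           offNeighbours ⟩
        H′ leftAt + H′ rightAt + H′ upAt + H′ downAt ≡⟨ cong₂ _+_ (cong₂ _+_ (cong₂ _+_
                                                           (cong (λ z → H (fin m i , z)) (fin-mod n (j + n')))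
                                                           (cong (λ z → H (fin m i , z)) (fin-mod n (suc j))))
                                                           (cong (λ z → H (z , fin n j)) (fin-mod m (i + m'))))
                                                           (cong (λ z → H (z , fin n j)) (fin-mod m (suc i))) ⟩
        H left + H right + H up + H down ∎
        where
        open ≡-Reasoning
        H′ : ℕ × ℕ → ℕ
        H′ (x , y) = H (fin m x , fin n y)
        offNeighbours : ∀ i' j' → i' < m → j' < n → (i' , j') ≢ leftAt → (i' , j') ≢ rightAt → (i' , j') ≢ upAt → (i' , j') ≢ downAt →
                        H′ (i' , j') ≡ 0
        offNeighbours i' j' i'<m j'<n n₁ n₂ n₃ n₄ = vanish _ (λ adj → notNeighbour (neighbours i' j' i'<m j'<n adj))
          where
          notNeighbour : (i' , j') ≡ leftAt ⊎ (i' , j') ≡ rightAt ⊎ (i' , j') ≡ upAt ⊎ (i' , j') ≡ downAt → ⊥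
          notNeighbour (inj₁ x) = n₁ x
          notNeighbour (inj₂ (inj₁ x)) = n₂ x
          notNeighbour (inj₂ (inj₂ (inj₁ x))) = n₃ x
          notNeighbour (inj₂ (inj₂ (inj₂ x))) = n₄ x

      indeg-neighbours : indeg G arc v ≡ ι (arc left v) + ι (arc right v) + ι (arc up v) + ι (arc down v)
      indeg-neighbours = trans (length-filter (λ u → arc u v) vertices) (sum-neighbours (λ u → ι (arc u v)) noArc)
        where
        noArc : ∀ u → ¬ Adj G u v → ι (arc u v) ≡ 0
        noArc u ¬adj with arc u v in e
        ... | true = ⊥-elim (¬adj (onEdges u v (subst T (sym e) tt)))
        ... | false = refl

      outdeg-neighbours : outdeg G arc v ≡ ι (arc v left) + ι (arc v right) + ι (arc v up) + ι (arc v down)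
      outdeg-neighbours = trans (length-filter (λ u → arc v u) vertices) (sum-neighbours (λ u → ι (arc v u)) noArc)
        where
        noArc : ∀ u → ¬ Adj G u v → ι (arc v u) ≡ 0
        noArc u ¬adj with arc v u in e
        ... | true = ⊥-elim (¬adj (adjSym G (onEdges v u (subst T (sym e) tt))))
        ... | false = refl

      edgeAt : ∀ X → Adj G X v → ι (arc X v) ≡ less (height X) (height v) × ι (arc v X) + ι (arc X v) ≡ 1
      edgeAt X adj with arc X v in e₁ | arc v X in e₂
      ... | true | true = ⊥-elim (antisym X v (subst T (sym e₁) tt) (subst T (sym e₂) tt))
      ... | true | false = sym (less-1 (height-arc (∈-vertices X) (subst T (sym e₁) tt))) , refl
      ... | false | true = sym (less-0 (<⇒≤ (height-arc (∈-vertices v) (subst T (sym e₂) tt)))) , refl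
      ... | false | false with covers X v adj
      ...   | inj₁ t = ⊥-elim (subst T e₁ t)
      ...   | inj₂ t = ⊥-elim (subst T e₂ t)

      adjLeft : Adj G left v
      adjLeft = inj₁ (refl , Cn.cycAdj-prev j j<n)
      adjRight : Adj G right v
      adjRight = inj₁ (refl , Cn.cycAdj-next j j<n)
      adjUp : Adj G up v
      adjUp = inj₂ (Cm.cycAdj-prev i i<m , refl)
      adjDown : Adj G down v
      adjDown = inj₂ (Cm.cycAdj-next i i<m , refl)

      indeg-lower : indeg G arc v ≡ lower i j
      indeg-lower = trans indeg-neighbours
        (cong₂ _+_ (cong₂ _+_ (cong₂ _+_ (proj₁ (edgeAt left adjLeft)) (proj₁ (edgeAt right adjRight)))
                              (proj₁ (edgeAt up adjUp))) (proj₁ (edgeAt down adjDown)))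

      degree-4 : outdeg G arc v + indeg G arc v ≡ 4
      degree-4 = trans (cong₂ _+_ outdeg-neighbours indeg-neighbours)
        (trans (pairUp (ι (arc v left)) (ι (arc v right)) (ι (arc v up)) (ι (arc v down))
                       (ι (arc left v)) (ι (arc right v)) (ι (arc up v)) (ι (arc down v)))
          (cong₂ _+_ (cong₂ _+_ (cong₂ _+_ (proj₂ (edgeAt left adjLeft)) (proj₂ (edgeAt right adjRight)))
                                (proj₂ (edgeAt up adjUp))) (proj₂ (edgeAt down adjDown))))
        where
        pairUp : ∀ o₁ o₂ o₃ o₄ i₁ i₂ i₃ i₄ → o₁ + o₂ + o₃ + o₄ + (i₁ + i₂ + i₃ + i₄) ≡ (o₁ + i₁) + (o₂ + i₂) + (o₃ + i₃) + (o₄ + i₄)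
        pairUp = solve-∀

      excess-deficit : outdeg G arc v ∸ indeg G arc v ≡ 2 * deficit i j
      excess-deficit = trans (degree4-excess (outdeg G arc v) (indeg G arc v) degree-4) (cong (λ z → 2 * (2 ∸ z)) indeg-lower)

    brushCost-deficit : brushCost G arc ≡ 2 * totalDeficit
    brushCost-deficit =
      trans (sum-vertices (λ v → outdeg G arc v ∸ indeg G arc v))
        (trans (Σ-cong m (λ i i<m → Σ-cong n (λ j j<n → Neighbourhood.excess-deficit i j i<m j<n)))
          (trans (Σ-cong m (λ i _ → Σ-* n 2 (deficit i))) (Σ-* m 2 (λ i → Σ< n (deficit i)))))

    brushCost-bound : 2 * (m + n ∸ 2) ≤ brushCost G arc
    brushCost-bound = subst (2 * (m + n ∸ 2) ≤_) (sym brushCost-deficit) (*-monoʳ-≤ 2 torusBound)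

mainTheorem2 : (m n : ℕ) → (hm : 3 ≤ m) → (hn : 3 ≤ n) →
    BrushNumber≥ (Cycle m hm □ Cycle n hn) (2 * (m + n ∸ 2))
mainTheorem2 .(3 + a₀) .(3 + b₀) hm@(s≤s (s≤s (s≤s {n = a₀} z≤n))) hn@(s≤s (s≤s (s≤s {n = b₀} z≤n))) arc orientation acyclic =
  TorusGraph.Oriented.brushCost-bound a₀ b₀ hm hn arc orientation acyclic
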